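{- Let $D=(V,A)$ be a finite directed graph, $\{S,T\}$ a partition of $V$ into nonempty sets with no arc from $T$ to $S$, and $w\in\mathbb{Z}_+^A$. For arbitrary $p\in\mathbb{Z}^S$ and $q\in\mathbb{Z}^T$: (1) If $\arg\min g_S[-p]\ne\emptyset$, then $p(u)\le0$ for every $u\in S$; moreover $p(u)=0$ whenever $\eta^*(u)\ge2$ for some $\eta^*\in\arg\min g_S[-p]$. (2) If $\arg\min g_T[+q]\ne\emptyset$, then $q(v)\ge0$ for every $v\in T$; moreover $q(v)=0$ whenever $\eta^*(v)\ge2$ for some $\eta^*\in\arg\min g_T[+q]$.
   Context: An arc $uv$ leaves $u$ and enters $v$. $A[X]$ denotes the arcs with both ends in $X$; $D[S]=(S,A[S])$, $D[T]=(T,A[T])$. A branching is an arc set with no directed cycle in which every vertex is entered by at most one arc; for a branching $B$ in $D[T]$, $R(B)$ is the set of vertices of $T$ entered by no arc of $B$. A cobranching is an arc set whose reversal is a branching; for a cobranching $B$ in $D[S]$, $R^*(B)$ is the set of vertices of $S$ left by no arc of $B$. For $\eta\in\mathbb{Z}^X$, $\mathrm{supp}^+(\eta)=\{u\in X:\eta(u)>0\}$. Define $g_T:\mathbb{Z}^T\to\mathbb{Z}\cup\{+\infty\}$ by $g_T(\eta)=\min\{w(B): B \text{ branching in } D[T],\ R(B)=\mathrm{supp}^+(\eta)\}$ if $\eta\in\mathbb{Z}_+^T$ and such a branching exists, and $+\infty$ otherwise; $g_S:\mathbb{Z}^S\to\mathbb{Z}\cup\{+\infty\}$ is defined analogously with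 cobranchings $B$ in $D[S]$ with $R^*(B)=\mathrm{supp}^+(\eta)$, $\eta\in\mathbb{Z}_+^S$. Here $w(B)=\sum_{a\in B}w(a)$. For $p\in\mathbb{Z}^S$, $q\in\mathbb{Z}^T$: $g_S[-p](\eta)=g_S(\eta)-\sum_{u\in S}p(u)\eta(u)$ and $g_T[+q](\zeta)=g_T(\zeta)+\sum_{v\in T}q(v)\zeta(v)$; $\arg\min$ denotes the set of minimizers (points of finite value attaining the infimum). -}

module Defs where

open import Data.Nat as ℕ using (ℕ; zero; suc)
open import Data.Fin using (Fin; zero; suc)
open import Data.Integer using (ℤ; +_; _+_; _*_; _≤_; _<_; 0ℤ)
open import Data.Bool using (Bool; true; false; if_then_else_)
open import Data.Sum using (_⊎_; inj₁; inj₂)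
open import Data.Product using (Σ; ∃; _×_; _,_)
open import Data.List using (List; []; _∷_)
open import Data.List.Relation.Unary.All using (All)
open import Data.Empty using (⊥)
open import Relation.Binary.PropositionalEquality using (_≡_)
open import Relation.Nullary using (¬_)

-- Vertex set V = S ⊎ T with S = Fin s, T = Fin t (a partition of V).
Vtx : ℕ → ℕ → Set
Vtx s t = Fin s ⊎ Fin t

sumFin : ∀ {k} → (Fin k → ℤ) → ℤ
sumFin {zero} f = 0ℤ
sumFin {suc k} f = f zero + sumFin (λ i → f (suc i))

⟨_,_⟩ : ∀ {k} → (Fin k → ℤ) → (Fin k → ℤ) → ℤ
⟨ p , η ⟩ = sumFin (λ x → p x * η x)

-- Arc sets of a digraph with arcs Fin m (arc a leaves tl a, enters hd a).
ArcSet : ℕ → Set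
ArcSet m = Fin m → Bool

module _ {V : Set} {m : ℕ} (tl hd : Fin m → V) where

  weight : (w : Fin m → ℕ) → ArcSet m → ℤ
  weight w B = sumFin (λ a → if B a then + w a else 0ℤ)

  Linked : V → List (Fin m) → V → Set
  Linked x [] y = x ≡ y
  Linked x (a ∷ as) y = (tl a ≡ x) × Linked (hd a) as y

  HasCycle : ArcSet m → Set
  HasCycle B = Σ (Fin m) λ a → Σ (List (Fin m)) λ as →
    All (λ b → B b ≡ true) (a ∷ as) × Linked (tl a) (a ∷ as) (tl a)

  InSub : (V → Set) → ArcSet m → Set
  InSub X B = ∀ a → B a ≡ true → X (tl a) × X (hd a)

  AtMostOneEntering : ArcSet m → Set
  AtMostOneEntering B = ∀ a a′ → B a ≡ true → B a′ ≡ true → hd a ≡ hd a′ → a ≡ a′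

  IsBranching : (V → Set) → ArcSet m → Set
  IsBranching X B = InSub X B × ¬ HasCycle B × AtMostOneEntering B

  Entered : ArcSet m → V → Set
  Entered B v = Σ (Fin m) λ a → (B a ≡ true) × (hd a ≡ v)

module _ {V : Set} {k : ℕ} (emb : Fin k → V) where
  InImg : V → Set
  InImg v = Σ (Fin k) λ x → emb x ≡ v

module _ {V : Set} {m k : ℕ} (tl hd : Fin m → V) (w : Fin m → ℕ) (emb : Fin k → V) where

  -- R(B) = supp⁺(η), where R(B) = vertices of X = image of emb entered by no arc of B
  RootsSupp : ArcSet m → (Fin k → ℤ) → Set
  RootsSupp B η = ∀ x → (¬ Entered tl hd B (emb x) → 0ℤ < η x) × (0ℤ < η x → ¬ Entered tl hd B (emb x))

  -- gVal η c  :⇔  g(η) = c (finite), where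
  -- g(η) = min { w(B) : B branching in D[X], R(B) = supp⁺(η) } for η ≥ 0, +∞ otherwise.
  gVal : (Fin k → ℤ) → ℤ → Set
  gVal η c = (∀ x → 0ℤ ≤ η x)
    × (Σ (ArcSet m) λ B → IsBranching tl hd InImg′ B × RootsSupp B η × (weight tl hd w B ≡ c))
    × (∀ B → IsBranching tl hd InImg′ B → RootsSupp B η → c ≤ weight tl hd w B)
    where InImg′ = InImg emb

gT : ∀ {s t m} → (tl hd : Fin m → Vtx s t) → (Fin m → ℕ) → (Fin t → ℤ) → ℤ → Set
gT tl hd w = gVal tl hd w inj₂

-- g_S : cobranchings in D[S] = branchings in the reversed digraph (tl/hd swapped);
-- R*(B) = vertices of S left by no arc of B.
gS : ∀ {s t m} → (tl hd : Fin m → Vtx s t) → (Fin m → ℕ) → (Fin s → ℤ) → ℤ → Set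
gS tl hd w = gVal hd tl w inj₁

ArgMin : ∀ {k} → ((Fin k → ℤ) → ℤ → Set) → ((Fin k → ℤ) → ℤ) → (Fin k → ℤ) → Set
ArgMin G φ η = Σ ℤ λ c → G η c × (∀ η′ c′ → G η′ c′ → c + φ η ≤ c′ + φ η′)

NoArcTS : ∀ {s t m} → (tl hd : Fin m → Vtx s t) → Set
NoArcTS tl hd = ∀ a x y → tl a ≡ inj₂ x → hd a ≡ inj₁ y → ⊥

module Submission where

-- Both halves are one statement about g = gVal (min-weight branchings in D[X]
-- with prescribed root set supp⁺ η), applied to the digraph and its reversal,
-- and a linear objective φ whose slope in coordinate u is r (that is
-- φ(η + d·e_u) = φ(η) + r·d).  At a minimiser η* of g + φ, witnessed by a
-- branching B of weight g(η*):
--   * raising η*(u) by 1 costs nothing in g: if η*(u) > 0 the support is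
--     unchanged and B still works; if η*(u) = 0 we delete the arcs of B
--     entering u, which makes u a root and does not increase the weight.
--     Optimality then forces r ≥ 0;
--   * if η*(u) ≥ 2, lowering η*(u) by 1 keeps the support, so B still works
--     and optimality forces r ≤ 0.
-- Since optimality is only stated against exact values of g, we first show
-- that a feasible branching bounds some attained value of g (a least weight
-- exists up to double negation, which suffices because ≤ on ℤ is decidable).

open import Defs
open import Data.Nat as ℕ using (ℕ)
open import Data.Fin using (Fin)
open import Data.Integer using (ℤ; +_; -_; _≤_; 0ℤ)
open import Data.Product using (Σ; _×_)
open import Relation.Binary.PropositionalEquality using (_≡_)

open import Data.Bool using (true; false; if_then_else_)
open import Data.Empty using (⊥-elim)
open import Data.Fin as Fin using (zero; suc)
import Data.Fin.Properties as FinP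
open import Data.Integer using (_+_; _*_; _<_; -1ℤ; ∣_∣; +≤+; +<+; _≤?_; _<?_)
open import Data.Integer.Properties
import Data.Nat.Properties as ℕP
open import Data.Nat.Induction using (<-rec)
import Data.List.Relation.Unary.All as All
open import Data.Product using (_,_; proj₁; proj₂)
open import Data.Sum using (inj₁; inj₂)
import Data.Sum.Properties as SumP
open import Relation.Nullary using (¬_; Dec; yes; no)
open import Relation.Nullary.Decidable using (decidable-stable)
open import Relation.Binary.Definitions using (DecidableEquality)
open import Relation.Binary.PropositionalEquality using (refl; sym; trans; cong; cong₂; subst; module ≡-Reasoning)

i≤i+j⇒0≤j : ∀ i j → i ≤ i + j → 0ℤ ≤ j
i≤i+j⇒0≤j i j i≤i+j = begin
  0ℤ            ≡⟨ +-inverseˡ i ⟨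
  - i + i       ≤⟨ +-monoʳ-≤ (- i) i≤i+j ⟩
  - i + (i + j) ≡⟨ +-assoc (- i) i j ⟨
  - i + i + j   ≡⟨ cong (_+ j) (+-inverseˡ i) ⟩
  0ℤ + j        ≡⟨ +-identityˡ j ⟩
  j             ∎
  where open ≤-Reasoning

-- A satisfiable predicate on ℕ has a least witness, up to double negation:
-- if there were none, strong induction would show there is no witness at all.
¬¬-least : (P : ℕ → Set) (n₀ : ℕ) → P n₀ → ¬ ¬ (Σ ℕ λ n → P n × (∀ n′ → P n′ → n ℕ.≤ n′))
¬¬-least P n₀ Pn₀ noLeast = noWitness n₀ Pn₀
  where
  noWitness : ∀ n → ¬ P n
  noWitness = <-rec (λ n → ¬ P n) λ n smaller Pn →
    noLeast (n , Pn , λ n′ Pn′ → ℕP.≮⇒≥ (λ n′<n → smaller n′<n Pn′))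

sumFin-mono : ∀ {k} {f g : Fin k → ℤ} → (∀ x → f x ≤ g x) → sumFin f ≤ sumFin g
sumFin-mono {ℕ.zero}  f≤g = ≤-refl
sumFin-mono {ℕ.suc k} f≤g = +-mono-≤ (f≤g zero) (sumFin-mono (λ x → f≤g (suc x)))

sumFin-nonneg : ∀ {k} {f : Fin k → ℤ} → (∀ x → 0ℤ ≤ f x) → 0ℤ ≤ sumFin f
sumFin-nonneg {ℕ.zero}  0≤f = ≤-refl
sumFin-nonneg {ℕ.suc k} 0≤f = +-mono-≤ (0≤f zero) (sumFin-nonneg (λ x → 0≤f (suc x)))

sumFin-cong : ∀ {k} {f g : Fin k → ℤ} → (∀ x → f x ≡ g x) → sumFin f ≡ sumFin g
sumFin-cong {ℕ.zero}  f≡g = refl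
sumFin-cong {ℕ.suc k} f≡g = cong₂ _+_ (f≡g zero) (sumFin-cong (λ x → f≡g (suc x)))

sumFin-update : ∀ {k} (f g : Fin k → ℤ) (u : Fin k) (e : ℤ)
  → (∀ x → ¬ x ≡ u → g x ≡ f x) → g u ≡ f u + e → sumFin g ≡ sumFin f + e
sumFin-update {ℕ.suc k} f g zero e same changed = begin
  g zero + sumFin (λ x → g (suc x))       ≡⟨ cong₂ _+_ changed (sumFin-cong (λ x → same (suc x) λ ())) ⟩
  f zero + e + sumFin (λ x → f (suc x))   ≡⟨ +-assoc (f zero) e _ ⟩
  f zero + (e + sumFin (λ x → f (suc x))) ≡⟨ cong (_+_ (f zero)) (+-comm e _) ⟩
  f zero + (sumFin (λ x → f (suc x)) + e) ≡⟨ +-assoc (f zero) _ e ⟨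
  f zero + sumFin (λ x → f (suc x)) + e   ∎
  where open ≡-Reasoning
sumFin-update {ℕ.suc k} f g (suc u) e same changed = begin
  g zero + sumFin (λ x → g (suc x))       ≡⟨ cong₂ _+_ (same zero λ ()) rest ⟩
  f zero + (sumFin (λ x → f (suc x)) + e) ≡⟨ +-assoc (f zero) _ e ⟨
  f zero + sumFin (λ x → f (suc x)) + e   ∎
  where
  open ≡-Reasoning
  rest : sumFin (λ x → g (suc x)) ≡ sumFin (λ x → f (suc x)) + e
  rest = sumFin-update (λ x → f (suc x)) (λ x → g (suc x)) u e
           (λ x x≢u → same (suc x) (λ eq → x≢u (FinP.suc-injective eq))) changed

bump : ∀ {k} → (Fin k → ℤ) → Fin k → ℤ → Fin k → ℤ
bump η u d x with x Fin.≟ u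
... | yes _ = η x + d
... | no  _ = η x

bump-at : ∀ {k} (η : Fin k → ℤ) u d → bump η u d u ≡ η u + d
bump-at η u d with u Fin.≟ u
... | yes _   = refl
... | no  u≢u = ⊥-elim (u≢u refl)

bump-off : ∀ {k} (η : Fin k → ℤ) u d x → ¬ x ≡ u → bump η u d x ≡ η x
bump-off η u d x x≢u with x Fin.≟ u
... | yes x≡u = ⊥-elim (x≢u x≡u)
... | no  _   = refl

NonNeg : ∀ {k} → (Fin k → ℤ) → Set
NonNeg η = ∀ x → 0ℤ ≤ η x

SameSupport : ∀ {k} → (Fin k → ℤ) → (Fin k → ℤ) → Set
SameSupport η η′ = ∀ x → (0ℤ < η x → 0ℤ < η′ x) × (0ℤ < η′ x → 0ℤ < η x)

bump-nonneg : ∀ {k} {η : Fin k → ℤ} {u d} → NonNeg η → 0ℤ ≤ η u + d → NonNeg (bump η u d)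
bump-nonneg {u = u} 0≤η 0≤η′u x with x Fin.≟ u
... | yes refl = 0≤η′u
... | no  _    = 0≤η x

bump-support : ∀ {k} {η : Fin k → ℤ} {u d} → 0ℤ < η u → 0ℤ < η u + d → SameSupport η (bump η u d)
bump-support {u = u} 0<ηu 0<η′u x with x Fin.≟ u
... | yes refl = (λ _ → 0<η′u) , (λ _ → 0<ηu)
... | no  _    = (λ 0<ηx → 0<ηx) , (λ 0<ηx → 0<ηx)

Slope : ∀ {k} → ((Fin k → ℤ) → ℤ) → Fin k → ℤ → Set
Slope φ u r = ∀ η d → φ (bump η u d) ≡ φ η + r * d

pairing-slope : ∀ {k} (p : Fin k → ℤ) u → Slope (λ η → ⟨ p , η ⟩) u (p u)
pairing-slope p u η d = sumFin-update (λ x → p x * η x) (λ x → p x * bump η u d x) u (p u * d)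
  (λ x x≢u → cong (_*_ (p x)) (bump-off η u d x x≢u))
  (trans (cong (_*_ (p u)) (bump-at η u d)) (*-distribˡ-+ (p u) (η u) d))

neg-slope : ∀ {k} {φ : (Fin k → ℤ) → ℤ} {u r} → Slope φ u r → Slope (λ η → - φ η) u (- r)
neg-slope {φ = φ} {u} {r} slope η d = begin
  - φ (bump η u d)     ≡⟨ cong -_ (slope η d) ⟩
  - (φ η + r * d)      ≡⟨ neg-distrib-+ (φ η) (r * d) ⟩
  - φ η + - (r * d)    ≡⟨ cong (_+_ (- φ η)) (neg-distribˡ-* r d) ⟩
  - φ η + - r * d      ∎
  where open ≡-Reasoning

module Rooted {V : Set} {m k : ℕ} (tl hd : Fin m → V) (w : Fin m → ℕ) (emb : Fin k → V) where

  g : (Fin k → ℤ) → ℤ → Set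
  g = gVal tl hd w emb

  wt : ArcSet m → ℤ
  wt = weight tl hd w

  Feasible : (Fin k → ℤ) → ArcSet m → Set
  Feasible η B = IsBranching tl hd (InImg emb) B × RootsSupp tl hd w emb B η

  _⊆_ : ArcSet m → ArcSet m → Set
  B′ ⊆ B = ∀ a → B′ a ≡ true → B a ≡ true

  branching-⊆ : ∀ {X B′ B} → B′ ⊆ B → IsBranching tl hd X B → IsBranching tl hd X B′
  branching-⊆ B′⊆B (inX , acyclic , oneEntering) =
      (λ a a∈B′ → inX a (B′⊆B a a∈B′))
    , (λ (a , as , onCycle , closed) → acyclic (a , as , All.map (λ {b} → B′⊆B b) onCycle , closed))
    , (λ a a′ a∈B′ a′∈B′ → oneEntering a a′ (B′⊆B a a∈B′) (B′⊆B a′ a′∈B′))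

  summand-nonneg : ∀ (B : ArcSet m) a → 0ℤ ≤ (if B a then + w a else 0ℤ)
  summand-nonneg B a with B a
  ... | true  = +≤+ ℕ.z≤n
  ... | false = ≤-refl

  entered-⊆ : ∀ {B′ B v} → B′ ⊆ B → Entered tl hd B′ v → Entered tl hd B v
  entered-⊆ B′⊆B (a , a∈B′ , enters) = a , B′⊆B a a∈B′ , enters

  weight-nonneg : ∀ (B : ArcSet m) → 0ℤ ≤ wt B
  weight-nonneg B = sumFin-nonneg (summand-nonneg B)

  weight-⊆ : ∀ {B′ B} → B′ ⊆ B → wt B′ ≤ wt B
  weight-⊆ {B′} {B} B′⊆B = sumFin-mono summand-mono
    where
    summand-mono : ∀ a → (if B′ a then + w a else 0ℤ) ≤ (if B a then + w a else 0ℤ)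
    summand-mono a with B′ a in a∈B′
    ... | true rewrite B′⊆B a a∈B′ = ≤-refl
    ... | false = summand-nonneg B a

  feasible-support : ∀ {η η′ B} → SameSupport η η′ → Feasible η B → Feasible η′ B
  feasible-support same (isBr , roots) =
    isBr , λ x → (λ notEntered → proj₁ (same x) (proj₁ (roots x) notEntered))
               , (λ 0<η′x → proj₂ (roots x) (proj₂ (same x) 0<η′x))

  -- Every feasible branching bounds an attained value of g from above.
  -- Weights are natural numbers, so a least one exists (up to double negation).
  value-attained : ∀ {η B} → NonNeg η → Feasible η B → ¬ ¬ (Σ ℤ λ c → g η c × c ≤ wt B)
  value-attained {η} {B} 0≤η feasB noValue =
    ¬¬-least HasWeight ∣ wt B ∣ (B , feasB , asNat B)
      λ (n , (B₀ , (isBr₀ , roots₀) , wB₀) , least) →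
        noValue (+ n , (0≤η , (B₀ , isBr₀ , roots₀ , wB₀) , λ B′ isBr′ roots′ → below least (isBr′ , roots′))
                , below least feasB)
    where
    HasWeight : ℕ → Set
    HasWeight n = Σ (ArcSet m) λ B → Feasible η B × (wt B ≡ + n)
    asNat : ∀ B → wt B ≡ + ∣ wt B ∣
    asNat B = sym (0≤i⇒+∣i∣≡i (weight-nonneg B))
    below : ∀ {n B′} → (∀ n′ → HasWeight n′ → n ℕ.≤ n′) → Feasible η B′ → + n ≤ wt B′
    below {n} {B′} least feasB′ =
      subst (+ n ≤_) (sym (asNat B′)) (+≤+ (least ∣ wt B′ ∣ (B′ , feasB′ , asNat B′)))

  -- An optimal point of g + φ beats every feasible pair (η′, B′), not only
  -- the exact values of g; the comparison is decidable, so ¬¬ can be removed.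
  argmin-bound : ∀ {φ η*} (opt : ArgMin g φ η*) {η′ B′}
    → NonNeg η′ → Feasible η′ B′ → proj₁ opt + φ η* ≤ wt B′ + φ η′
  argmin-bound {φ} {η*} (c , _ , best) {η′} {B′} 0≤η′ feasB′ =
    decidable-stable (c + φ η* ≤? wt B′ + φ η′) λ fails →
      value-attained 0≤η′ feasB′ λ (c′ , gc′ , c′≤wB′) →
        fails (≤-trans (best η′ c′ gc′) (+-monoˡ-≤ (φ η′) c′≤wB′))

  move-nonneg : ∀ {φ u r η* d B′} → Slope φ u r → (opt : ArgMin g φ η*)
    → NonNeg (bump η* u d) → Feasible (bump η* u d) B′ → wt B′ ≤ proj₁ opt → 0ℤ ≤ r * d
  move-nonneg {φ} {u} {r} {η*} {d} {B′} slope opt@(c , _) 0≤η′ feasB′ light =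
    i≤i+j⇒0≤j (c + φ η*) (r * d) (begin
      c + φ η*                 ≤⟨ argmin-bound opt 0≤η′ feasB′ ⟩
      wt B′ + φ (bump η* u d)  ≤⟨ +-monoˡ-≤ (φ (bump η* u d)) light ⟩
      c + φ (bump η* u d)      ≡⟨ cong (_+_ c) (slope η* d) ⟩
      c + (φ η* + r * d)       ≡⟨ +-assoc c (φ η*) (r * d) ⟨
      c + φ η* + r * d         ∎)
    where open ≤-Reasoning

  -- Making a vertex a root needs the vertices to be distinguishable and X to
  -- be embedded injectively.
  module Optimality (_≟V_ : DecidableEquality V) (emb-injective : ∀ {x y} → emb x ≡ emb y → x ≡ y) where

    prune : Fin k → ArcSet m → ArcSet m
    prune u B a with hd a ≟V emb u
    ... | yes _ = false
    ... | no  _ = B a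

    prune-⊆ : ∀ u B → prune u B ⊆ B
    prune-⊆ u B a a∈ with hd a ≟V emb u
    prune-⊆ u B a () | yes _
    prune-⊆ u B a a∈ | no  _ = a∈

    prune-other : ∀ u B a → ¬ hd a ≡ emb u → prune u B a ≡ B a
    prune-other u B a notU with hd a ≟V emb u
    ... | yes entersU = ⊥-elim (notU entersU)
    ... | no  _       = refl

    prune-root : ∀ u B → ¬ Entered tl hd (prune u B) (emb u)
    prune-root u B (a , a∈ , enters) with hd a ≟V emb u
    prune-root u B (a , () , enters) | yes _
    prune-root u B (a , a∈ , enters) | no notU = notU enters

    prune-keeps : ∀ {u B x} → ¬ x ≡ u → Entered tl hd B (emb x) → Entered tl hd (prune u B) (emb x)
    prune-keeps {u} {B} x≢u (a , a∈B , enters) =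
      a , trans (prune-other u B a notU) a∈B , enters
      where
      notU : ¬ hd a ≡ emb u
      notU entersU = x≢u (emb-injective (trans (sym enters) entersU))

    prune-feasible : ∀ {η u B} → η u ≡ 0ℤ → Feasible η B → Feasible (bump η u (+ 1)) (prune u B)
    prune-feasible {η} {u} {B} ηu≡0 (isBr , roots) = branching-⊆ {X = InImg emb} (prune-⊆ u B) isBr , roots′
      where
      roots′ : RootsSupp tl hd w emb (prune u B) (bump η u (+ 1))
      roots′ x with x Fin.≟ u
      ... | yes refl = (λ _ → subst (λ z → 0ℤ < z + + 1) (sym ηu≡0) (+<+ (ℕ.s≤s ℕ.z≤n)))
                     , (λ _ → prune-root u B)
      ... | no  x≢u  = (λ notEntered → proj₁ (roots x) (λ entered → notEntered (prune-keeps x≢u entered)))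
                     , (λ 0<ηx entered → proj₂ (roots x) 0<ηx (entered-⊆ (prune-⊆ u B) entered))

    -- At a minimiser of g + φ, φ has nonnegative slope in every coordinate:
    -- raising coordinate u is always possible without increasing g.
    argmin-slope-nonneg : ∀ {φ u r η*} → Slope φ u r → ArgMin g φ η* → 0ℤ ≤ r
    argmin-slope-nonneg {φ} {u} {r} {η*} slope opt@(c , (0≤η* , (B , isBr , roots , wB≡c) , _) , _) =
      subst (0ℤ ≤_) (*-identityʳ r) (raise (0ℤ <? η* u))
      where
      0≤η′ : NonNeg (bump η* u (+ 1))
      0≤η′ = bump-nonneg 0≤η* (≤-trans (0≤η* u) (i≤i+j (η* u) (+ 1)))
      raise : Dec (0ℤ < η* u) → 0ℤ ≤ r * + 1
      raise (yes 0<η*u) = move-nonneg {r = r} slope opt 0≤η′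
        (feasible-support (bump-support 0<η*u (<-≤-trans 0<η*u (i≤i+j (η* u) (+ 1)))) (isBr , roots))
        (≤-reflexive wB≡c)
      raise (no ¬0<η*u) = move-nonneg {r = r} slope opt 0≤η′
        (prune-feasible (≤-antisym (≮⇒≥ ¬0<η*u) (0≤η* u)) (isBr , roots))
        (≤-trans (weight-⊆ (prune-⊆ u B)) (≤-reflexive wB≡c))

    -- Where a minimiser is at least 2, lowering by 1 keeps the support, so
    -- the slope is also nonpositive, hence zero.
    argmin-slope-zero : ∀ {φ u r η*} → Slope φ u r → ArgMin g φ η* → + 2 ≤ η* u → r ≡ 0ℤ
    argmin-slope-zero {φ} {u} {r} {η*} slope opt@(c , (0≤η* , (B , isBr , roots , wB≡c) , _) , _) 2≤η*u =
      ≤-antisym r≤0 (argmin-slope-nonneg slope opt)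
      where
      0<η*u : 0ℤ < η* u
      0<η*u = <-≤-trans (+<+ (ℕ.s≤s ℕ.z≤n)) (≤-trans (+≤+ (ℕ.s≤s ℕ.z≤n)) 2≤η*u)
      0<η′u : 0ℤ < η* u + -1ℤ
      0<η′u = <-≤-trans (+<+ (ℕ.s≤s ℕ.z≤n)) (+-monoˡ-≤ -1ℤ 2≤η*u)
      lower : 0ℤ ≤ r * -1ℤ
      lower = move-nonneg {r = r} slope opt (bump-nonneg 0≤η* (<⇒≤ 0<η′u))
        (feasible-support (bump-support 0<η*u 0<η′u) (isBr , roots))
        (≤-reflexive wB≡c)
      r≤0 : r ≤ 0ℤ
      r≤0 = neg-cancel-≤ {0ℤ} {r} (subst (0ℤ ≤_) (trans (*-comm r -1ℤ) (-1*i≡-i r)) lower)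

-- g_S is g for the reversed digraph on S (cobranchings), g_T is g on T.
-- The objective -⟨p,·⟩ has slope -p(u) and ⟨q,·⟩ has slope q(v).
lemma3 : ∀ {s t m : ℕ} (tl hd : Fin m → Vtx s t) (w : Fin m → ℕ)
    → 0 ℕ.< s → 0 ℕ.< t → NoArcTS tl hd
    → (p : Fin s → ℤ) (q : Fin t → ℤ)
    → ((Σ (Fin s → ℤ) (ArgMin (gS tl hd w) (λ η → - ⟨ p , η ⟩))) → ∀ u → p u ≤ 0ℤ)
    × (∀ η* → ArgMin (gS tl hd w) (λ η → - ⟨ p , η ⟩) η* → ∀ u → + 2 ≤ η* u → p u ≡ 0ℤ)
    × ((Σ (Fin t → ℤ) (ArgMin (gT tl hd w) (λ ζ → ⟨ q , ζ ⟩))) → ∀ v → 0ℤ ≤ q v)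
    × (∀ ζ* → ArgMin (gT tl hd w) (λ ζ → ⟨ q , ζ ⟩) ζ* → ∀ v → + 2 ≤ ζ* v → q v ≡ 0ℤ)
lemma3 {s} {t} tl hd w _ _ _ p q =
    (λ (η* , opt) u → neg-cancel-≤ {0ℤ} {p u} (S.argmin-slope-nonneg (slopeS u) opt))
  , (λ η* opt u 2≤η*u → neg-injective {p u} {0ℤ} (S.argmin-slope-zero (slopeS u) opt 2≤η*u))
  , (λ (ζ* , opt) v → T.argmin-slope-nonneg (pairing-slope q v) opt)
  , (λ ζ* opt v 2≤ζ*v → T.argmin-slope-zero (pairing-slope q v) opt 2≤ζ*v)
  where
  _≟V_ : DecidableEquality (Vtx s t)
  _≟V_ = SumP.≡-dec Fin._≟_ Fin._≟_
  module S = Rooted.Optimality hd tl w inj₁ _≟V_ SumP.inj₁-injective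
  module T = Rooted.Optimality tl hd w inj₂ _≟V_ SumP.inj₂-injective
  slopeS : ∀ u → Slope (λ η → - ⟨ p , η ⟩) u (- p u)
  slopeS u = neg-slope {φ = λ η → ⟨ p , η ⟩} {u} {p u} (pairing-slope p u)
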